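{- (1) Every directed cycle of length $k\ge 3$ is $(2,3)$-cordial. (2) Every directed path (a path $v_1,\dots,v_n$ with arcs $\overrightarrow{v_iv_{i+1}}$ for all $i$) is $(2,3)$-cordial. (3) If $n\ge 4$ and $D$ is an out-star or an in-star on $n$ vertices (a star whose arcs are all directed from the center to the leaves, respectively all from the leaves to the center), then $D$ is not $(2,3)$-cordial.
   Context: A $(0,1)$-labeling $f$ of a finite set $Z$ is friendly if $-1\le |f^{ -1}(0)|-|f^{ -1}(1)|\le 1$; more generally, a labeling $h:Z\to \mathcal{A}$ is friendly if $-1\le |h^{ -1}(i)|-|h^{ -1}(j)|\le 1$ for all $i,j\in\mathcal{A}$. For a digraph $D=(V,A)$ without loops, multiple arcs or digons, and a friendly labeling $f:V\to\{0,1\}$, the induced arc labeling is $g:A\to\{1,0,-1\}$, $g(\overrightarrow{uv})=f(v)-f(u)$ for the arc directed from $u$ to $v$. The labeling is $(2,3)$-cordial if $g$ is friendly (the numbers of arcs labeled $1$, $0$, $-1$ pairwise differ by at most $1$), and $D$ is a $(2,3)$-cordial digraph if it admits such a friendly vertex labeling $f$. -}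

module Defs where

open import Data.Nat using (ℕ; zero; suc; _≤_)
open import Data.Integer using (ℤ; +_; _-_; -[1+_])
import Data.Integer.Properties as ℤP
open import Data.Fin using (Fin; toℕ; inject₁; fromℕ)
import Data.Fin.Properties as FinP
open import Data.List using (List; []; _∷_; map; length; filter; allFin)
open import Data.Product using (_×_; _,_)
open import Data.Sum using (_⊎_)
open import Relation.Binary.PropositionalEquality using (_≡_)
open import Data.Product using (Σ)

_≈₁_ : ℕ → ℕ → Set
a ≈₁ b = (a ≤ suc b) × (b ≤ suc a)

-- A digraph on vertex set Fin n is given by its list of arcs (u , v), meaning u → v.
Arcs : ℕ → Set
Arcs n = List (Fin n × Fin n)

Labeling : ℕ → Set
Labeling n = Fin n → Fin 2

vcount : {n : ℕ} → Labeling n → Fin 2 → ℕ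
vcount {n} f i = length (filter (λ v → f v FinP.≟ i) (allFin n))

FriendlyV : {n : ℕ} → Labeling n → Set
FriendlyV f = vcount f Fin.zero ≈₁ vcount f (Fin.suc Fin.zero)

arcLabel : {n : ℕ} → Labeling n → Fin n × Fin n → ℤ
arcLabel f (u , v) = + toℕ (f v) - + toℕ (f u)

acount : {n : ℕ} → Labeling n → Arcs n → ℤ → ℕ
acount f as c = length (filter (λ a → arcLabel f a ℤP.≟ c) as)

FriendlyA : {n : ℕ} → Labeling n → Arcs n → Set
FriendlyA f as =
  (acount f as (+ 1) ≈₁ acount f as (+ 0)) ×
  (acount f as (+ 1) ≈₁ acount f as -[1+ 0 ]) ×
  (acount f as (+ 0) ≈₁ acount f as -[1+ 0 ])

Cordial23 : (n : ℕ) → Arcs n → Set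
Cordial23 n as = Σ (Labeling n) (λ f → FriendlyV f × FriendlyA f as)

pathArcs : (m : ℕ) → Arcs (suc m)
pathArcs m = map (λ i → (inject₁ i , Fin.suc i)) (allFin m)

-- directed cycle v₀ → v₁ → ⋯ → v_m → v₀ of length suc m
cycleArcs : (m : ℕ) → Arcs (suc m)
cycleArcs m = (fromℕ m , Fin.zero) ∷ pathArcs m

outStarArcs : (m : ℕ) → Arcs (suc m)
outStarArcs m = map (λ i → (Fin.zero , Fin.suc i)) (allFin m)

inStarArcs : (m : ℕ) → Arcs (suc m)
inStarArcs m = map (λ i → (Fin.suc i , Fin.zero)) (allFin m)

{-# OPTIONS --safe #-}
-- Label the vertices of a path or cycle periodically by 0 1 1 0 1 0. One period
-- contains three 0s and three 1s, and its six consecutive arcs carry each of the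
-- labels 1, 0, −1 exactly twice; so all counts grow in lockstep from one period to
-- the next, and balance only has to be checked on the six prefixes of a period
-- (together with the closing arc for a cycle). In a star all arcs share the centre:
-- an arc labelled 1 leaves a 0 and enters a 1, an arc labelled −1 leaves a 1 and
-- enters a 0, so whatever the centre's label one of ±1 is missing, and a friendly
-- arc labelling then has at most two arcs.
module Submission where

open import Defs
open import Algebra.Properties.CommutativeSemigroup as CommSemigroupProperties using ()
open import Data.Bool using (Bool; true; false)
open import Data.Fin using (Fin; zero; suc; toℕ; fromℕ<; fromℕ; inject₁)
import Data.Fin.Properties as FinP
open FinP using (all?; toℕ-fromℕ<; toℕ-fromℕ; toℕ-inject₁)
open import Data.Integer using (ℤ; +_; _-_; -[1+_])
import Data.Integer.Properties as ℤP
open import Data.List using ([]; _∷_; map; length; filter; allFin; tabulate)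
open import Data.List.Properties using (length-map; length-tabulate; map-tabulate; filter-none)
open import Data.List.Relation.Unary.All as All using (All)
open import Data.List.Relation.Unary.All.Properties using (map⁺; tabulate⁺)
open import Data.Nat using (ℕ; zero; suc; s≤s; _+_; _∸_; _≤_; _<_; _≤?_; _<?_; NonZero; >-nonZero⁻¹; s≤s⁻¹)
open import Data.Nat.Induction using (<-rec)
open import Data.Nat.Properties
  using (+-assoc; +-suc; +-identityʳ; +-monoʳ-≤; +-mono-≤; ≤-trans; ≤-reflexive; ≮⇒≥;
         m+[n∸m]≡n; ∸-monoʳ-<; +-commutativeSemigroup)
open import Data.Nat.Tactic.RingSolver using (solve-∀)
open import Data.Product using (_×_; _,_; proj₁; proj₂)
open import Data.Sum using (_⊎_; inj₁; inj₂)
open import Function using (_∘_)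
open import Relation.Nullary using (¬_; Dec; yes; no; does)
open import Relation.Nullary.Decidable using (_×-dec_; from-yes)
open import Relation.Unary using (Decidable)
open import Relation.Binary.PropositionalEquality
  using (_≡_; _≢_; refl; sym; trans; cong; cong₂; subst; subst₂; module ≡-Reasoning)

open CommSemigroupProperties +-commutativeSemigroup using (x∙yz≈y∙xz)
open ≡-Reasoning

indicator : Bool → ℕ
indicator true  = 1
indicator false = 0

count : (ℕ → Bool) → ℕ → ℕ
count b zero    = 0
count b (suc n) = indicator (b 0) + count (b ∘ suc) n

count-cong : ∀ {b b′} → (∀ j → b j ≡ b′ j) → ∀ n → count b n ≡ count b′ n
count-cong eq zero    = refl
count-cong eq (suc n) = cong₂ _+_ (cong indicator (eq 0)) (count-cong (eq ∘ suc) n)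

count-+ : ∀ b m n → count b (m + n) ≡ count b m + count (λ j → b (m + j)) n
count-+ b zero    n = refl
count-+ b (suc m) n = begin
  indicator (b 0) + count (b ∘ suc) (m + n)
    ≡⟨ cong (_+_ (indicator (b 0))) (count-+ (b ∘ suc) m n) ⟩
  indicator (b 0) + (count (b ∘ suc) m + count (λ j → b (suc m + j)) n)
    ≡⟨ sym (+-assoc (indicator (b 0)) _ _) ⟩
  count b (suc m) + count (λ j → b (suc m + j)) n ∎

count-periodic : ∀ p b → (∀ j → b (p + j) ≡ b j) → ∀ n → count b (p + n) ≡ count b p + count b n
count-periodic p b periodic n =
  trans (count-+ b p n) (cong (_+_ (count b p)) (count-cong periodic n))

length-filter-∷ : ∀ {A : Set} {P : A → Set} (P? : Decidable P) x xs →
  length (filter P? (x ∷ xs)) ≡ indicator (does (P? x)) + length (filter P? xs)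
length-filter-∷ P? x xs with does (P? x)
... | true  = refl
... | false = refl

length-filter-tabulate : ∀ {A : Set} {P : A → Set} (P? : Decidable P) {n} (e : Fin n → A) b →
  (∀ i → does (P? (e i)) ≡ b (toℕ i)) → length (filter P? (tabulate e)) ≡ count b n
length-filter-tabulate P? {zero}  e b eq = refl
length-filter-tabulate P? {suc n} e b eq = begin
  length (filter P? (e zero ∷ tabulate (e ∘ suc)))
    ≡⟨ length-filter-∷ P? (e zero) (tabulate (e ∘ suc)) ⟩
  indicator (does (P? (e zero))) + length (filter P? (tabulate (e ∘ suc)))
    ≡⟨ cong₂ _+_ (cong indicator (eq zero)) (length-filter-tabulate P? (e ∘ suc) (b ∘ suc) (eq ∘ suc)) ⟩
  count b (suc n) ∎

periodic-induction : ∀ p .{{_ : NonZero p}} (P : ℕ → Set) →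
  (∀ (i : Fin p) → P (toℕ i)) → (∀ n → P n → P (p + n)) → ∀ n → P n
periodic-induction p P base step = <-rec P go
  where
  go : ∀ n → (∀ {m} → m < n → P m) → P n
  go n rec with n <? p
  ... | yes n<p = subst P (toℕ-fromℕ< n<p) (base (fromℕ< n<p))
  ... | no n≮p  = subst P (m+[n∸m]≡n p≤n) (step (n ∸ p) (rec (∸-monoʳ-< (>-nonZero⁻¹ p) p≤n)))
    where p≤n = ≮⇒≥ n≮p

_≈₁?_ : ∀ a b → Dec (a ≈₁ b)
a ≈₁? b = (a ≤? suc b) ×-dec (b ≤? suc a)

+-≈₁ : ∀ t {a b} → a ≈₁ b → (t + a) ≈₁ (t + b)
+-≈₁ t {a} {b} (a≤1+b , b≤1+a) =
  ≤-trans (+-monoʳ-≤ t a≤1+b) (≤-reflexive (+-suc t b)) ,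
  ≤-trans (+-monoʳ-≤ t b≤1+a) (≤-reflexive (+-suc t a))

Balanced : ℕ × ℕ × ℕ → Set
Balanced (x , y , z) = x ≈₁ y × x ≈₁ z × y ≈₁ z

balanced? : ∀ t → Dec (Balanced t)
balanced? (x , y , z) = (x ≈₁? y) ×-dec ((x ≈₁? z) ×-dec (y ≈₁? z))

+-balanced : ∀ t {x y z} → Balanced (x , y , z) → Balanced (t + x , t + y , t + z)
+-balanced t (xy , xz , yz) = +-≈₁ t xy , +-≈₁ t xz , +-≈₁ t yz

balanced-sum≤2 : ∀ {x y z} → Balanced (x , y , z) → x ≡ 0 ⊎ z ≡ 0 → x + y + z ≤ 2
balanced-sum≤2 (xy , xz , yz) (inj₁ refl) = +-mono-≤ (proj₂ xy) (proj₂ xz)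
balanced-sum≤2 {x} {y} (xy , xz , yz) (inj₂ refl) =
  subst (_≤ 2) (sym (+-identityʳ (x + y))) (+-mono-≤ (proj₁ xz) (proj₁ yz))

labelCounts : (ℤ → ℕ) → ℕ × ℕ × ℕ
labelCounts F = F (+ 1) , F (+ 0) , F -[1+ 0 ]

labelCounts-cong : ∀ {F G : ℤ → ℕ} → (∀ c → F c ≡ G c) → labelCounts F ≡ labelCounts G
labelCounts-cong eq = cong₂ _,_ (eq (+ 1)) (cong₂ _,_ (eq (+ 0)) (eq -[1+ 0 ]))

acount-∷ : ∀ {n} (f : Labeling n) a as c →
  acount f (a ∷ as) c ≡ indicator (does (arcLabel f a ℤP.≟ c)) + acount f as c
acount-∷ f a as c = length-filter-∷ (λ a → arcLabel f a ℤP.≟ c) a as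

acount-none : ∀ {n} (f : Labeling n) {as c} → All (λ a → arcLabel f a ≢ c) as → acount f as c ≡ 0
acount-none f {c = c} none = cong length (filter-none (λ a → arcLabel f a ℤP.≟ c) none)

exactly-one-label : ∀ {n} (f : Labeling n) a →
  indicator (does (arcLabel f a ℤP.≟ (+ 1))) + indicator (does (arcLabel f a ℤP.≟ (+ 0)))
    + indicator (does (arcLabel f a ℤP.≟ -[1+ 0 ])) ≡ 1
exactly-one-label f (u , v) with f u | f v
... | zero     | zero     = refl
... | zero     | suc zero = refl
... | suc zero | zero     = refl
... | suc zero | suc zero = refl

acount-total : ∀ {n} (f : Labeling n) as →
  acount f as (+ 1) + acount f as (+ 0) + acount f as -[1+ 0 ] ≡ length as
acount-total f []       = refl
acount-total f (a ∷ as) = begin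
  acount f (a ∷ as) (+ 1) + acount f (a ∷ as) (+ 0) + acount f (a ∷ as) -[1+ 0 ]
    ≡⟨ cong₂ _+_ (cong₂ _+_ (acount-∷ f a as (+ 1)) (acount-∷ f a as (+ 0)))
                 (acount-∷ f a as -[1+ 0 ]) ⟩
  (hit (+ 1) + acount f as (+ 1)) + (hit (+ 0) + acount f as (+ 0)) + (hit -[1+ 0 ] + acount f as -[1+ 0 ])
    ≡⟨ interchange (hit (+ 1)) (hit (+ 0)) (hit -[1+ 0 ]) _ _ _ ⟩
  (hit (+ 1) + hit (+ 0) + hit -[1+ 0 ]) + (acount f as (+ 1) + acount f as (+ 0) + acount f as -[1+ 0 ])
    ≡⟨ cong₂ _+_ (exactly-one-label f a) (acount-total f as) ⟩
  suc (length as) ∎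
  where
  hit : ℤ → ℕ
  hit c = indicator (does (arcLabel f a ℤP.≟ c))

  interchange : ∀ a b c d e f → (a + d) + (b + e) + (c + f) ≡ (a + b + c) + (d + e + f)
  interchange = solve-∀

arcLabel≡1 : ∀ {n} (f : Labeling n) {u v} → arcLabel f (u , v) ≡ + 1 → f u ≡ zero × f v ≡ suc zero
arcLabel≡1 f {u} {v} eq with f u | f v
... | zero     | suc zero = refl , refl
... | zero     | zero     with () ← eq
... | suc zero | zero     with () ← eq
... | suc zero | suc zero with () ← eq

arcLabel≡-1 : ∀ {n} (f : Labeling n) {u v} → arcLabel f (u , v) ≡ -[1+ 0 ] → f u ≡ suc zero × f v ≡ zero
arcLabel≡-1 f {u} {v} eq with f u | f v
... | suc zero | zero     = refl , refl
... | zero     | zero     with () ← eq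
... | zero     | suc zero with () ← eq
... | suc zero | suc zero with () ← eq

¬FriendlyA-missingLabel : ∀ {n} (f : Labeling n) as → 3 ≤ length as →
  acount f as (+ 1) ≡ 0 ⊎ acount f as -[1+ 0 ] ≡ 0 → ¬ FriendlyA f as
¬FriendlyA-missingLabel f as 3≤len missing friendly with
  ≤-trans 3≤len (≤-trans (≤-reflexive (sym (acount-total f as))) (balanced-sum≤2 friendly missing))
... | s≤s (s≤s ())

missingLabel-commonSource : ∀ {n} (f : Labeling n) {u as} → All (λ a → proj₁ a ≡ u) as →
  acount f as (+ 1) ≡ 0 ⊎ acount f as -[1+ 0 ] ≡ 0
missingLabel-commonSource f {u} fromU with f u in fu
... | zero     = inj₂ (acount-none f (All.map noArc fromU))
  where
  noArc : ∀ {a} → proj₁ a ≡ u → arcLabel f a ≢ -[1+ 0 ]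
  noArc {_ , _} refl eq with () ← trans (sym fu) (proj₁ (arcLabel≡-1 f eq))
... | suc zero = inj₁ (acount-none f (All.map noArc fromU))
  where
  noArc : ∀ {a} → proj₁ a ≡ u → arcLabel f a ≢ (+ 1)
  noArc {_ , _} refl eq with () ← trans (sym fu) (proj₁ (arcLabel≡1 f eq))

missingLabel-commonTarget : ∀ {n} (f : Labeling n) {v as} → All (λ a → proj₂ a ≡ v) as →
  acount f as (+ 1) ≡ 0 ⊎ acount f as -[1+ 0 ] ≡ 0
missingLabel-commonTarget f {v} intoV with f v in fv
... | zero     = inj₁ (acount-none f (All.map noArc intoV))
  where
  noArc : ∀ {a} → proj₂ a ≡ v → arcLabel f a ≢ (+ 1)
  noArc {_ , _} refl eq with () ← trans (sym fv) (proj₂ (arcLabel≡1 f eq))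
... | suc zero = inj₂ (acount-none f (All.map noArc intoV))
  where
  noArc : ∀ {a} → proj₂ a ≡ v → arcLabel f a ≢ -[1+ 0 ]
  noArc {_ , _} refl eq with () ← trans (sym fv) (proj₂ (arcLabel≡-1 f eq))

¬Cordial23-commonSource : ∀ {n u} (as : Arcs n) → 3 ≤ length as → All (λ a → proj₁ a ≡ u) as →
  ¬ Cordial23 n as
¬Cordial23-commonSource as 3≤len fromU (f , _ , friendly) =
  ¬FriendlyA-missingLabel f as 3≤len (missingLabel-commonSource f fromU) friendly

¬Cordial23-commonTarget : ∀ {n v} (as : Arcs n) → 3 ≤ length as → All (λ a → proj₂ a ≡ v) as →
  ¬ Cordial23 n as
¬Cordial23-commonTarget as 3≤len intoV (f , _ , friendly) =
  ¬FriendlyA-missingLabel f as 3≤len (missingLabel-commonTarget f intoV) friendly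

length-map-allFin : ∀ {m n} (g : Fin m → Fin n × Fin n) → length (map g (allFin m)) ≡ m
length-map-allFin {m} g = trans (length-map g (allFin m)) (length-tabulate (λ i → i))

label : ℕ → Fin 2
label 0 = zero
label 1 = suc zero
label 2 = suc zero
label 3 = zero
label 4 = suc zero
label 5 = zero
label (suc (suc (suc (suc (suc (suc j)))))) = label j

labeling : ∀ {n} → Labeling n
labeling v = label (toℕ v)

hasLabel : Fin 2 → ℕ → Bool
hasLabel i j = does (label j FinP.≟ i)

stepLabel : ℕ → ℤ
stepLabel j = + toℕ (label (suc j)) - + toℕ (label j)

closingLabel : ℕ → ℤ
closingLabel k = + toℕ (label 0) - + toℕ (label k)

pathCounts : ℕ → ℤ → ℕ
pathCounts m c = count (λ j → does (stepLabel j ℤP.≟ c)) m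

cycleCounts : ℕ → ℤ → ℕ
cycleCounts k c = indicator (does (closingLabel k ℤP.≟ c)) + pathCounts k c

vcount-labeling : ∀ n i → vcount (labeling {n}) i ≡ count (hasLabel i) n
vcount-labeling n i = length-filter-tabulate (λ v → labeling v FinP.≟ i) {n} (λ v → v) (hasLabel i) (λ _ → refl)

acount-path : ∀ m c → acount labeling (pathArcs m) c ≡ pathCounts m c
acount-path m c = begin
  length (filter P? (map arc (tabulate (λ i → i))))  ≡⟨ cong (length ∘ filter P?) (map-tabulate (λ i → i) arc) ⟩
  length (filter P? (tabulate arc))                  ≡⟨ length-filter-tabulate P? arc _ arcLabel-step ⟩
  pathCounts m c                                     ∎
  where
  arc : Fin m → Fin (suc m) × Fin (suc m)
  arc i = inject₁ i , suc i

  P? : Decidable (λ a → arcLabel labeling a ≡ c)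
  P? a = arcLabel labeling a ℤP.≟ c

  arcLabel-step : ∀ i → does (P? (arc i)) ≡ does (stepLabel (toℕ i) ℤP.≟ c)
  arcLabel-step i rewrite toℕ-inject₁ i = refl

acount-cycle : ∀ k c → acount labeling (cycleArcs k) c ≡ cycleCounts k c
acount-cycle k c = begin
  acount labeling (cycleArcs k) c
    ≡⟨ acount-∷ labeling (fromℕ k , zero) (pathArcs k) c ⟩
  indicator (does (arcLabel labeling (fromℕ k , zero) ℤP.≟ c)) + acount labeling (pathArcs k) c
    ≡⟨ cong₂ _+_ closing (acount-path k c) ⟩
  cycleCounts k c ∎
  where
  closing : indicator (does (arcLabel labeling (fromℕ k , zero) ℤP.≟ c)) ≡ indicator (does (closingLabel k ℤP.≟ c))
  closing rewrite toℕ-fromℕ k = refl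

vertexCounts-balanced : ∀ n → count (hasLabel zero) n ≈₁ count (hasLabel (suc zero)) n
vertexCounts-balanced = periodic-induction 6 P (from-yes (all? {n = 6} λ i → P? (toℕ i))) step
  where
  P : ℕ → Set
  P n = count (hasLabel zero) n ≈₁ count (hasLabel (suc zero)) n
  P? : ∀ n → Dec (P n)
  P? n = _ ≈₁? _
  step : ∀ n → P n → P (6 + n)
  step n = subst₂ _≈₁_ (sym (count-periodic 6 (hasLabel zero) (λ _ → refl) n))
                       (sym (count-periodic 6 (hasLabel (suc zero)) (λ _ → refl) n))
         ∘ +-≈₁ 3

pathCounts-periodic : ∀ n c → pathCounts (6 + n) c ≡ pathCounts 6 c + pathCounts n c
pathCounts-periodic n c = count-periodic 6 _ (λ _ → refl) n

cycleCounts-periodic : ∀ n c → cycleCounts (6 + n) c ≡ pathCounts 6 c + cycleCounts n c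
cycleCounts-periodic n c =
  trans (cong (_+_ (indicator (does (closingLabel n ℤP.≟ c)))) (pathCounts-periodic n c))
        (x∙yz≈y∙xz _ (pathCounts 6 c) (pathCounts n c))

balanced-periodic : ∀ (F : ℕ → ℤ → ℕ) →
  (∀ n c → F (6 + n) c ≡ pathCounts 6 c + F n c) →
  (∀ (i : Fin 6) → Balanced (labelCounts (F (toℕ i)))) →
  ∀ n → Balanced (labelCounts (F n))
balanced-periodic F periodic base = periodic-induction 6 (Balanced ∘ labelCounts ∘ F) base step
  where
  step : ∀ n → Balanced (labelCounts (F n)) → Balanced (labelCounts (F (6 + n)))
  step n = subst Balanced (labelCounts-cong (λ c → sym (periodic n c))) ∘ +-balanced 2

pathCounts-balanced : ∀ m → Balanced (labelCounts (pathCounts m))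
pathCounts-balanced = balanced-periodic pathCounts pathCounts-periodic
  (from-yes (all? {n = 6} λ i → balanced? (labelCounts (pathCounts (toℕ i)))))

cycleCounts-balanced : ∀ k → Balanced (labelCounts (cycleCounts k))
cycleCounts-balanced = balanced-periodic cycleCounts cycleCounts-periodic
  (from-yes (all? {n = 6} λ i → balanced? (labelCounts (cycleCounts (toℕ i)))))

friendlyV-labeling : ∀ n → FriendlyV (labeling {n})
friendlyV-labeling n =
  subst₂ _≈₁_ (sym (vcount-labeling n zero)) (sym (vcount-labeling n (suc zero))) (vertexCounts-balanced n)

path-cordial : ∀ m → Cordial23 (suc m) (pathArcs m)
path-cordial m = labeling , friendlyV-labeling (suc m) ,
  subst Balanced (labelCounts-cong (sym ∘ acount-path m)) (pathCounts-balanced m)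

cycle-cordial : ∀ k → Cordial23 (suc k) (cycleArcs k)
cycle-cordial k = labeling , friendlyV-labeling (suc k) ,
  subst Balanced (labelCounts-cong (sym ∘ acount-cycle k)) (cycleCounts-balanced k)

3≤length-star : ∀ {m n} → 4 ≤ suc m → (g : Fin m → Fin n × Fin n) → 3 ≤ length (map g (allFin m))
3≤length-star 4≤1+m g = ≤-trans (s≤s⁻¹ 4≤1+m) (≤-reflexive (sym (length-map-allFin g)))

outStar-¬cordial : ∀ m → 4 ≤ suc m → ¬ Cordial23 (suc m) (outStarArcs m)
outStar-¬cordial m 4≤1+m =
  ¬Cordial23-commonSource (outStarArcs m) (3≤length-star 4≤1+m _) (map⁺ (tabulate⁺ (λ _ → refl)))

inStar-¬cordial : ∀ m → 4 ≤ suc m → ¬ Cordial23 (suc m) (inStarArcs m)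
inStar-¬cordial m 4≤1+m =
  ¬Cordial23-commonTarget (inStarArcs m) (3≤length-star 4≤1+m _) (map⁺ (tabulate⁺ (λ _ → refl)))

mainTheorem3 :
    ((k : ℕ) → 3 ≤ suc k → Cordial23 (suc k) (cycleArcs k)) ×
    ((m : ℕ) → Cordial23 (suc m) (pathArcs m)) ×
    ((m : ℕ) → 4 ≤ suc m →
      ¬ Cordial23 (suc m) (outStarArcs m) × ¬ Cordial23 (suc m) (inStarArcs m))
mainTheorem3 =
  -- The labeling also works for the degenerate cycles of length 1 and 2.
  (λ k _ → cycle-cordial k) ,
  path-cordial ,
  (λ m 4≤1+m → outStar-¬cordial m 4≤1+m , inStar-¬cordial m 4≤1+m)
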